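{- Let $k,m$ be positive integers, $n=k+m$, let $Q$ be the complete bipartite poset of type $(k,m)$, $A=\{x_{k+1},\dots,x_n\}$ and $M=\mathbf{I}(Q,A)$. Let $X\in M$ and let $L$, with $[k]\subseteq L\subseteq[n]$, be such that $X\in J_{\mathbf{1}_L}$. Then the map $\rho:H_X\to H_{\mathbf{1}_L}$, $Y\mapsto Y\mathbf{1}_L$, is an isomorphism, and its inverse is given by $Y\mapsto YXX^{ -1}$.
   Context: Work over $\mathbb{C}$. The complete bipartite poset of type $(k,m)$ is $Q=\{x_1,\dots,x_n\}$ with $x_i<x_j$ iff $i\le k<j$, no other strict relations. $M=\mathbf{I}(Q,A)=\{\begin{bmatrix}\mathbf{1}_k&B\\0&D\end{bmatrix}: B\in\mathrm{Mat}_{k,m},\ D\text{ diagonal }m\times m\}$ is the Zariski closure of $\mathbf{T}_n(A)\ltimes\mathbf{U}_n(Q)$ (invertible diagonal matrices with first $k$ entries $1$, times upper unitriangular matrices supported on the relations of $Q$). $M$ is completely regular, so each $\mathcal{H}$-class is a group; $H_X$ is the $\mathcal{H}$-class of $X$, $J_{\mathbf{1}_L}$ the $\mathcal{J}$-class of $\mathbf{1}_L$, and $X^{ -1}$ denotes the inverse of $X$ in the group $H_X$ (so $XX^{ -1}=X^{ -1}X$ is the identity of $H_X$). For $L\subseteq[n]$, $\mathbf{1}_L$ is the diagonal matrix with $j$-th diagonal entry $1$ if $j\in L$ and $0$ otherwise. -}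

module Defs where

open import Level using (Level; _⊔_) renaming (suc to lsuc)
open import Algebra.Bundles using (CommutativeRing)
open import Data.Nat as ℕ using (ℕ; zero; suc)
open import Data.Fin using (Fin; toℕ)
import Data.Fin as Fin
open import Data.Fin.Subset using (Subset; _∈_; _∉_)
open import Data.List using (List; []; _∷_; length)
open import Data.Product using (Σ; ∃; _×_; _,_)
open import Relation.Nullary using (¬_; yes; no)
import Data.Fin.Properties as FinP
import Data.Fin.Subset.Properties as SubP
open import Relation.Binary.PropositionalEquality using (_≡_; _≢_)

record Field (c ℓ : Level) : Set (lsuc (c ⊔ ℓ)) where
  field
    commRing : CommutativeRing c ℓ
  open CommutativeRing commRing public
  field
    0#≉1#    : ¬ (0# ≈ 1#)
    inverse  : ∀ x → ¬ (x ≈ 0#) → Σ Carrier (λ y → (x * y) ≈ 1#)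

module FieldOps {c ℓ} (F : Field c ℓ) where
  open Field F

  fromℕ : ℕ → Carrier
  fromℕ zero    = 0#
  fromℕ (suc n) = 1# + fromℕ n

  -- polynomial given by its coefficient list a₀ ∷ a₁ ∷ ... (lowest first)
  evalPoly : List Carrier → Carrier → Carrier
  evalPoly []       x = 0#
  evalPoly (a ∷ as) x = a + x * evalPoly as x

  -- leading coefficient (last entry) is nonzero and degree ≥ 1
  data NonConstant : List Carrier → Set (c ⊔ ℓ) where
    top  : ∀ a b → ¬ (b ≈ 0#) → NonConstant (a ∷ b ∷ [])
    cons : ∀ a {as} → NonConstant as → NonConstant (a ∷ as)

record ACF0 (c ℓ : Level) : Set (lsuc (c ⊔ ℓ)) where
  field
    field′ : Field c ℓ
  open Field field′ public
  open FieldOps field′ public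
  field
    charZero        : ∀ n → ¬ (fromℕ (suc n) ≈ 0#)
    algClosed       : ∀ p → NonConstant p → Σ Carrier (λ x → evalPoly p x ≈ 0#)

module Matrices {c ℓ} (K : ACF0 c ℓ) (k m : ℕ) where
  open ACF0 K

  n : ℕ
  n = k ℕ.+ m

  Mat : Set c
  Mat = Fin n → Fin n → Carrier

  sumFin : ∀ {r} → (Fin r → Carrier) → Carrier
  sumFin {zero}  f = 0#
  sumFin {suc r} f = f Fin.zero + sumFin (λ i → f (Fin.suc i))

  _·_ : Mat → Mat → Mat
  (X · Y) i j = sumFin (λ l → X i l * Y l j)

  infixl 7 _·_

  _≋_ : Mat → Mat → Set ℓ
  X ≋ Y = ∀ i j → X i j ≈ Y i j

  infix 4 _≋_

  -- M = { [ 1_k  B ; 0  D ] : B arbitrary k×m, D diagonal m×m }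
  -- (indices 0..k-1 are x₁..x_k, indices k..n-1 are x_{k+1}..x_n)
  record InM (X : Mat) : Set ℓ where
    field
      topLeft-diag    : ∀ i → toℕ i ℕ.< k → X i i ≈ 1#
      topLeft-offdiag : ∀ i j → toℕ i ℕ.< k → toℕ j ℕ.< k → i ≢ j → X i j ≈ 0#
      bottomLeft      : ∀ i j → k ℕ.≤ toℕ i → toℕ j ℕ.< k → X i j ≈ 0#
      bottomRight     : ∀ i j → k ℕ.≤ toℕ i → k ℕ.≤ toℕ j → i ≢ j → X i j ≈ 0#

  one : Subset n → Mat
  one L i j with i FinP.≟ j | i SubP.∈? L
  ... | yes _ | yes _ = 1#
  ... | yes _ | no  _ = 0#
  ... | no  _ | _     = 0#

  -- Green's relations of the monoid M (M has identity, so M¹ = M)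
  _≤R_ : Mat → Mat → Set (c ⊔ ℓ)
  X ≤R Y = Σ Mat (λ U → InM U × X ≋ Y · U)

  _≤L_ : Mat → Mat → Set (c ⊔ ℓ)
  X ≤L Y = Σ Mat (λ U → InM U × X ≋ U · Y)

  _≤J_ : Mat → Mat → Set (c ⊔ ℓ)
  X ≤J Y = Σ Mat (λ U → Σ Mat (λ V → InM U × InM V × X ≋ U · Y · V))

  _𝓡_ _𝓛_ _𝓗_ _𝓙_ : Mat → Mat → Set (c ⊔ ℓ)
  X 𝓡 Y = X ≤R Y × Y ≤R X
  X 𝓛 Y = X ≤L Y × Y ≤L X
  X 𝓗 Y = X 𝓡 Y × X 𝓛 Y
  X 𝓙 Y = X ≤J Y × Y ≤J X

  _∈H_ : Mat → Mat → Set (c ⊔ ℓ)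
  Y ∈H X = InM Y × Y 𝓗 X

  _∈J_ : Mat → Mat → Set (c ⊔ ℓ)
  Y ∈J X = InM Y × Y 𝓙 X

  -- Xi is the inverse of X in the group H_X:
  -- Xi ∈ H_X, X Xi = Xi X, and X Xi is the identity of H_X (X Xi X = X)
  record IsGroupInverse (X Xi : Mat) : Set (c ⊔ ℓ) where
    field
      inH      : Xi ∈H X
      commutes : X · Xi ≋ Xi · X
      unitL    : X · Xi · X ≋ X

-- An element of M is determined by its diagonal block D and its upper right block B, and
-- multiplication acts column by column: (YZ)_jj = Y_jj Z_jj and (YZ)_ij = Z_ij + Y_ij Z_jj for
-- i ≤ k < j.  An element X of J_{1_L} has D-entries that are units on L and zero off L; such
-- elements are 𝓗-related exactly when their B-columns outside L coincide.  The group H_X has the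
-- explicit identity E with D = 1_L, B-columns zero on L and equal to those of X off L, and an
-- explicit inverse of X.  E is a left identity on the whole J-class and a right identity on H_X,
-- and 1_L is the corresponding element for H_{1_L}; with associativity of the product on M this
-- makes Y ↦ Y 1_L and Z ↦ Z X X⁻¹ = Z E mutually inverse.
module Submission where

open import Algebra.Bundles using (CommutativeRing)
import Algebra.Properties.CommutativeSemigroup as CommutativeSemigroupProperties
import Algebra.Properties.Group as GroupProperties
import Algebra.Properties.Ring as RingProperties
open import Data.Fin as Fin using (Fin; toℕ)
import Data.Fin.Properties as FinP
open import Data.Fin.Subset using (Subset; _∈_; _∉_)
open import Data.Fin.Subset.Properties using (_∈?_)
open import Data.Nat as ℕ using (ℕ; _<_; _≤_; _≤?_)
open import Data.Nat.Properties using (≰⇒>; <⇒≱)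
open import Data.Product using (Σ; _×_; _,_; proj₁; proj₂)
open import Function.Base using (_∘_)
open import Level using (_⊔_)
open import Relation.Binary.Bundles using (Setoid)
open import Relation.Binary.PropositionalEquality as ≡ using (_≢_)
open import Relation.Nullary using (yes; no)
open import Relation.Nullary.Negation using (contradiction)

open import Defs

module CommutativeRingLemmas {c ℓ} (R : CommutativeRing c ℓ) where
  open CommutativeRing R
  open CommutativeSemigroupProperties *-commutativeSemigroup
    using (interchange; xy∙z≈y∙xz; xy∙z≈x∙zy)
  open RingProperties ring using (-‿distribˡ-*)
  open import Relation.Binary.Reasoning.Setoid setoid

  *-≈0ʳ : ∀ {a z} → z ≈ 0# → a * z ≈ 0#
  *-≈0ʳ {a} z≈0 = trans (*-congˡ z≈0) (zeroʳ a)

  *-≈0ˡ : ∀ {a z} → z ≈ 0# → z * a ≈ 0#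
  *-≈0ˡ {a} z≈0 = trans (*-congʳ z≈0) (zeroˡ a)

  *-≈1ʳ : ∀ {a z} → z ≈ 1# → a * z ≈ a
  *-≈1ʳ {a} z≈1 = trans (*-congˡ z≈1) (*-identityʳ a)

  +-≈0ˡ : ∀ {a z} → z ≈ 0# → z + a ≈ a
  +-≈0ˡ {a} z≈0 = trans (+-congʳ z≈0) (+-identityˡ a)

  +-≈0ʳ : ∀ {a z} → z ≈ 0# → a + z ≈ a
  +-≈0ʳ {a} z≈0 = trans (+-congˡ z≈0) (+-identityʳ a)

  +-*-≈0ʳ : ∀ {a b z} → z ≈ 0# → a + b * z ≈ a
  +-*-≈0ʳ z≈0 = +-≈0ʳ (*-≈0ʳ z≈0)

  +-*-≈0ˡ : ∀ {a b z} → z ≈ 0# → a + z * b ≈ a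
  +-*-≈0ˡ z≈0 = +-≈0ʳ (*-≈0ˡ z≈0)

  unit-cancelʳ : ∀ {a x y b} → x * y ≈ 1# → a * x ≈ b * x → a ≈ b
  unit-cancelʳ {a} {x} {y} {b} xy≈1 ax≈bx = begin
    a           ≈⟨ *-≈1ʳ xy≈1 ⟨
    a * (x * y) ≈⟨ *-assoc a x y ⟨
    a * x * y   ≈⟨ *-congʳ ax≈bx ⟩
    b * x * y   ≈⟨ *-assoc b x y ⟩
    b * (x * y) ≈⟨ *-≈1ʳ xy≈1 ⟩
    b           ∎

  unit-factorʳ : ∀ {a x y} → a * x * y ≈ 1# → x * (a * y) ≈ 1#
  unit-factorʳ {a} {x} {y} axy≈1 = trans (sym (xy∙z≈y∙xz a x y)) axy≈1

  unit-* : ∀ {x a y b} → x * a ≈ 1# → y * b ≈ 1# → x * y * (a * b) ≈ 1#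
  unit-* {x} {a} {y} {b} xa≈1 yb≈1 =
    trans (interchange x y a b) (trans (*-cong xa≈1 yb≈1) (*-identityʳ 1#))

  +-neg-*-unit : ∀ a {x y} → x * y ≈ 1# → a + - (a * y) * x ≈ 0#
  +-neg-*-unit a {x} {y} xy≈1 = begin
    a + - (a * y) * x   ≈⟨ +-congˡ (-‿distribˡ-* (a * y) x) ⟨
    a + - (a * y * x)   ≈⟨ +-congˡ (-‿cong (trans (xy∙z≈x∙zy a y x) (*-≈1ʳ xy≈1))) ⟩
    a + - a             ≈⟨ -‿inverseʳ a ⟩
    0#                  ∎

  *-distrib-assoc : ∀ a b c d e → a + (b + c * d) * e ≈ (a + b * e) + c * (d * e)
  *-distrib-assoc a b c d e = begin
    a + (b + c * d) * e        ≈⟨ +-congˡ (distribʳ e b (c * d)) ⟩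
    a + (b * e + c * d * e)    ≈⟨ +-assoc a (b * e) (c * d * e) ⟨
    a + b * e + c * d * e      ≈⟨ +-congˡ (*-assoc c d e) ⟩
    a + b * e + c * (d * e)    ∎

module BlockMatrices {c ℓ} (K : ACF0 c ℓ) (k m : ℕ) where
  open ACF0 K
  open Matrices K k m
  open CommutativeRingLemmas commRing
  open InM

  <k≤⇒≢ : ∀ {i j : Fin n} → toℕ i < k → k ≤ toℕ j → i ≢ j
  <k≤⇒≢ i<k k≤j ≡.refl = <⇒≱ i<k k≤j

  sumFin-cong : ∀ {r} {f g : Fin r → Carrier} → (∀ l → f l ≈ g l) → sumFin f ≈ sumFin g
  sumFin-cong {ℕ.zero}  f≈g = refl
  sumFin-cong {ℕ.suc r} f≈g = +-cong (f≈g Fin.zero) (sumFin-cong (λ l → f≈g (Fin.suc l)))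

  sumFin-zero : ∀ {r} (f : Fin r → Carrier) → (∀ l → f l ≈ 0#) → sumFin f ≈ 0#
  sumFin-zero {ℕ.zero}  f f≈0 = refl
  sumFin-zero {ℕ.suc r} f f≈0 = trans (+-≈0ˡ (f≈0 Fin.zero)) (sumFin-zero _ (f≈0 ∘ Fin.suc))

  sumFin-single : ∀ {r} (f : Fin r → Carrier) a → (∀ l → l ≢ a → f l ≈ 0#) → sumFin f ≈ f a
  sumFin-single {ℕ.suc r} f Fin.zero f≈0 = +-≈0ʳ (sumFin-zero _ (λ l → f≈0 (Fin.suc l) (λ ())))
  sumFin-single {ℕ.suc r} f (Fin.suc a) f≈0 =
    trans (+-≈0ˡ (f≈0 Fin.zero (λ ())))
          (sumFin-single _ a (λ l l≢a → f≈0 (Fin.suc l) (l≢a ∘ FinP.suc-injective)))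

  sumFin-pair : ∀ {r} (f : Fin r → Carrier) a b → a ≢ b →
                (∀ l → l ≢ a → l ≢ b → f l ≈ 0#) → sumFin f ≈ f a + f b
  sumFin-pair {ℕ.suc r} f Fin.zero Fin.zero a≢b f≈0 = contradiction ≡.refl a≢b
  sumFin-pair {ℕ.suc r} f Fin.zero (Fin.suc b) a≢b f≈0 =
    +-congˡ (sumFin-single _ b (λ l l≢b → f≈0 (Fin.suc l) (λ ()) (l≢b ∘ FinP.suc-injective)))
  sumFin-pair {ℕ.suc r} f (Fin.suc a) Fin.zero a≢b f≈0 =
    trans (+-congˡ (sumFin-single _ a (λ l l≢a → f≈0 (Fin.suc l) (l≢a ∘ FinP.suc-injective) (λ ()))))
          (+-comm _ _)
  sumFin-pair {ℕ.suc r} f (Fin.suc a) (Fin.suc b) a≢b f≈0 =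
    trans (+-≈0ˡ (f≈0 Fin.zero (λ ()) (λ ())))
          (sumFin-pair _ a b (a≢b ∘ ≡.cong Fin.suc)
            (λ l l≢a l≢b → f≈0 (Fin.suc l) (l≢a ∘ FinP.suc-injective) (l≢b ∘ FinP.suc-injective)))

  ≋-refl : ∀ {A} → A ≋ A
  ≋-refl i j = refl

  ≋-sym : ∀ {A B} → A ≋ B → B ≋ A
  ≋-sym A≋B i j = sym (A≋B i j)

  ≋-trans : ∀ {A B C} → A ≋ B → B ≋ C → A ≋ C
  ≋-trans A≋B B≋C i j = trans (A≋B i j) (B≋C i j)

  ≋-setoid : Setoid c ℓ
  ≋-setoid = record
    { Carrier       = Mat
    ; _≈_           = _≋_
    ; isEquivalence = record { refl = ≋-refl ; sym = ≋-sym ; trans = ≋-trans }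
    }

  ·-congˡ : ∀ {A B B′} → B ≋ B′ → A · B ≋ A · B′
  ·-congˡ B≋B′ i j = sumFin-cong (λ l → *-congˡ (B≋B′ l j))

  ·-congʳ : ∀ {A A′ B} → A ≋ A′ → A · B ≋ A′ · B
  ·-congʳ A≋A′ i j = sumFin-cong (λ l → *-congʳ (A≋A′ i l))

  module _ {A B : Mat} (A∈M : InM A) (B∈M : InM B) where

    ·-leftColumn : ∀ i j → toℕ j < k → (A · B) i j ≈ A i j
    ·-leftColumn i j j<k = trans (sumFin-single _ j vanish) (*-≈1ʳ (topLeft-diag B∈M j j<k))
      where
      vanish : ∀ l → l ≢ j → A i l * B l j ≈ 0#
      vanish l l≢j with k ≤? toℕ l
      ... | yes k≤l = *-≈0ʳ (bottomLeft B∈M l j k≤l j<k)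
      ... | no  k≰l = *-≈0ʳ (topLeft-offdiag B∈M l j (≰⇒> k≰l) j<k l≢j)

    ·-lowerRow : ∀ i j → k ≤ toℕ i → (A · B) i j ≈ A i i * B i j
    ·-lowerRow i j k≤i = sumFin-single _ i vanish
      where
      vanish : ∀ l → l ≢ i → A i l * B l j ≈ 0#
      vanish l l≢i with k ≤? toℕ l
      ... | yes k≤l = *-≈0ˡ (bottomRight A∈M i l k≤i k≤l (l≢i ∘ ≡.sym))
      ... | no  k≰l = *-≈0ˡ (bottomLeft A∈M i l k≤i (≰⇒> k≰l))

    ·-diag : ∀ j → k ≤ toℕ j → (A · B) j j ≈ A j j * B j j
    ·-diag j = ·-lowerRow j j

    ·-block : ∀ i j → toℕ i < k → k ≤ toℕ j → (A · B) i j ≈ B i j + A i j * B j j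
    ·-block i j i<k k≤j =
      trans (sumFin-pair _ i j (<k≤⇒≢ i<k k≤j) vanish)
            (+-congʳ (trans (*-congʳ (topLeft-diag A∈M i i<k)) (*-identityˡ _)))
      where
      vanish : ∀ l → l ≢ i → l ≢ j → A i l * B l j ≈ 0#
      vanish l l≢i l≢j with k ≤? toℕ l
      ... | yes k≤l = *-≈0ʳ (bottomRight B∈M l j k≤l k≤j l≢j)
      ... | no  k≰l = *-≈0ˡ (topLeft-offdiag A∈M i l i<k (≰⇒> k≰l) (l≢i ∘ ≡.sym))

    InM-· : InM (A · B)
    InM-· = record
      { topLeft-diag    = λ i i<k → trans (·-leftColumn i i i<k) (topLeft-diag A∈M i i<k)
      ; topLeft-offdiag = λ i j i<k j<k i≢j →
          trans (·-leftColumn i j j<k) (topLeft-offdiag A∈M i j i<k j<k i≢j)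
      ; bottomLeft      = λ i j k≤i j<k → trans (·-leftColumn i j j<k) (bottomLeft A∈M i j k≤i j<k)
      ; bottomRight     = λ i j k≤i k≤j i≢j →
          trans (·-lowerRow i j k≤i) (*-≈0ʳ (bottomRight B∈M i j k≤i k≤j i≢j))
      }

  ≋-byBlocks : ∀ {A B} → InM A → InM B →
               (∀ j → k ≤ toℕ j → A j j ≈ B j j) →
               (∀ i j → toℕ i < k → k ≤ toℕ j → A i j ≈ B i j) → A ≋ B
  ≋-byBlocks A∈M B∈M diag≈ block≈ i j with k ≤? toℕ i | k ≤? toℕ j | i FinP.≟ j
  ... | yes k≤i | _       | yes ≡.refl = diag≈ i k≤i
  ... | yes k≤i | yes k≤j | no i≢j =
    trans (bottomRight A∈M i j k≤i k≤j i≢j) (sym (bottomRight B∈M i j k≤i k≤j i≢j))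
  ... | yes k≤i | no  k≰j | no _ =
    trans (bottomLeft A∈M i j k≤i (≰⇒> k≰j)) (sym (bottomLeft B∈M i j k≤i (≰⇒> k≰j)))
  ... | no  k≰i | yes k≤j | _ = block≈ i j (≰⇒> k≰i) k≤j
  ... | no  k≰i | no  _   | yes ≡.refl =
    trans (topLeft-diag A∈M i (≰⇒> k≰i)) (sym (topLeft-diag B∈M i (≰⇒> k≰i)))
  ... | no  k≰i | no  k≰j | no i≢j =
    trans (topLeft-offdiag A∈M i j (≰⇒> k≰i) (≰⇒> k≰j) i≢j)
          (sym (topLeft-offdiag B∈M i j (≰⇒> k≰i) (≰⇒> k≰j) i≢j))

  ·-assoc : ∀ {A B C} → InM A → InM B → InM C → (A · B) · C ≋ A · (B · C)
  ·-assoc {A} {B} {C} A∈M B∈M C∈M =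
    ≋-byBlocks (InM-· (InM-· A∈M B∈M) C∈M) (InM-· A∈M (InM-· B∈M C∈M)) diag≈ block≈
    where
    open import Relation.Binary.Reasoning.Setoid setoid
    diag≈ : ∀ j → k ≤ toℕ j → ((A · B) · C) j j ≈ (A · (B · C)) j j
    diag≈ j k≤j = begin
      ((A · B) · C) j j          ≈⟨ ·-diag (InM-· A∈M B∈M) C∈M j k≤j ⟩
      (A · B) j j * C j j        ≈⟨ *-congʳ (·-diag A∈M B∈M j k≤j) ⟩
      A j j * B j j * C j j      ≈⟨ *-assoc _ _ _ ⟩
      A j j * (B j j * C j j)    ≈⟨ *-congˡ (·-diag B∈M C∈M j k≤j) ⟨
      A j j * (B · C) j j        ≈⟨ ·-diag A∈M (InM-· B∈M C∈M) j k≤j ⟨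
      (A · (B · C)) j j          ∎
    block≈ : ∀ i j → toℕ i < k → k ≤ toℕ j → ((A · B) · C) i j ≈ (A · (B · C)) i j
    block≈ i j i<k k≤j = begin
      ((A · B) · C) i j                            ≈⟨ ·-block (InM-· A∈M B∈M) C∈M i j i<k k≤j ⟩
      C i j + (A · B) i j * C j j                  ≈⟨ +-congˡ (*-congʳ (·-block A∈M B∈M i j i<k k≤j)) ⟩
      C i j + (B i j + A i j * B j j) * C j j      ≈⟨ *-distrib-assoc _ _ _ _ _ ⟩
      (C i j + B i j * C j j) + A i j * (B j j * C j j)
        ≈⟨ +-cong (·-block B∈M C∈M i j i<k k≤j) (*-congˡ (·-diag B∈M C∈M j k≤j)) ⟨
      (B · C) i j + A i j * (B · C) j j             ≈⟨ ·-block A∈M (InM-· B∈M C∈M) i j i<k k≤j ⟨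
      (A · (B · C)) i j                            ∎

  fromBlocks : (Fin n → Carrier) → (Fin n → Fin n → Carrier) → Mat
  fromBlocks d b i j with k ≤? toℕ i | k ≤? toℕ j | i FinP.≟ j
  ... | yes _ | _     | yes _ = d j
  ... | no  _ | yes _ | _     = b i j
  ... | no  _ | no  _ | yes _ = 1#
  ... | _     | _     | no  _ = 0#

  module _ (d : Fin n → Carrier) (b : Fin n → Fin n → Carrier) where

    fromBlocks-diag : ∀ j → k ≤ toℕ j → fromBlocks d b j j ≈ d j
    fromBlocks-diag j k≤j with k ≤? toℕ j | j FinP.≟ j
    ... | yes _   | yes _   = refl
    ... | yes _   | no  j≢j = contradiction ≡.refl j≢j
    ... | no  k≰j | _       = contradiction k≤j k≰j

    fromBlocks-block : ∀ i j → toℕ i < k → k ≤ toℕ j → fromBlocks d b i j ≈ b i j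
    fromBlocks-block i j i<k k≤j with k ≤? toℕ i | k ≤? toℕ j | i FinP.≟ j
    ... | yes k≤i | _       | _ = contradiction k≤i (<⇒≱ i<k)
    ... | no  _   | yes _   | _ = refl
    ... | no  _   | no  k≰j | _ = contradiction k≤j k≰j

    InM-fromBlocks : InM (fromBlocks d b)
    InM-fromBlocks = record
      { topLeft-diag = upperDiag ; topLeft-offdiag = upperOffdiag
      ; bottomLeft = lowerLeft ; bottomRight = lowerOffdiag }
      where
      upperDiag : ∀ i → toℕ i < k → fromBlocks d b i i ≈ 1#
      upperDiag i i<k with k ≤? toℕ i | i FinP.≟ i
      ... | yes k≤i | _       = contradiction k≤i (<⇒≱ i<k)
      ... | no  _   | yes _   = refl
      ... | no  _   | no  i≢i = contradiction ≡.refl i≢i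
      upperOffdiag : ∀ i j → toℕ i < k → toℕ j < k → i ≢ j → fromBlocks d b i j ≈ 0#
      upperOffdiag i j i<k j<k i≢j with k ≤? toℕ i | k ≤? toℕ j | i FinP.≟ j
      ... | _       | _       | yes i≡j = contradiction i≡j i≢j
      ... | yes k≤i | _       | no  _   = contradiction k≤i (<⇒≱ i<k)
      ... | no  _   | yes k≤j | no  _   = contradiction k≤j (<⇒≱ j<k)
      ... | no  _   | no  _   | no  _   = refl
      lowerLeft : ∀ i j → k ≤ toℕ i → toℕ j < k → fromBlocks d b i j ≈ 0#
      lowerLeft i j k≤i j<k with k ≤? toℕ i | k ≤? toℕ j | i FinP.≟ j
      ... | _     | _ | yes ≡.refl = contradiction k≤i (<⇒≱ j<k)
      ... | yes _ | _ | no  _      = refl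
      ... | no  k≰i | _ | no  _    = contradiction k≤i k≰i
      lowerOffdiag : ∀ i j → k ≤ toℕ i → k ≤ toℕ j → i ≢ j → fromBlocks d b i j ≈ 0#
      lowerOffdiag i j k≤i k≤j i≢j with k ≤? toℕ i | k ≤? toℕ j | i FinP.≟ j
      ... | _       | _ | yes i≡j = contradiction i≡j i≢j
      ... | yes _   | _ | no  _   = refl
      ... | no  k≰i | _ | no  _   = contradiction k≤i k≰i

  module _ (L : Subset n) where

    one-∈ : ∀ j → j ∈ L → one L j j ≈ 1#
    one-∈ j j∈L with j FinP.≟ j | j ∈? L
    ... | yes _   | yes _   = refl
    ... | yes _   | no  j∉L = contradiction j∈L j∉L
    ... | no  j≢j | _       = contradiction ≡.refl j≢j

    one-∉ : ∀ j → j ∉ L → one L j j ≈ 0#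
    one-∉ j j∉L with j FinP.≟ j | j ∈? L
    ... | yes _ | yes j∈L = contradiction j∈L j∉L
    ... | yes _ | no  _   = refl
    ... | no  _ | _       = refl

    one-≢ : ∀ i j → i ≢ j → one L i j ≈ 0#
    one-≢ i j i≢j with i FinP.≟ j | i ∈? L
    ... | yes i≡j | _ = contradiction i≡j i≢j
    ... | no  _   | _ = refl

    InM-one : (∀ i → toℕ i < k → i ∈ L) → InM (one L)
    InM-one [k]⊆L = record
      { topLeft-diag    = λ i i<k → one-∈ i ([k]⊆L i i<k)
      ; topLeft-offdiag = λ i j _ _ → one-≢ i j
      ; bottomLeft      = λ i j k≤i j<k → one-≢ i j (<k≤⇒≢ j<k k≤i ∘ ≡.sym)
      ; bottomRight     = λ i j _ _ → one-≢ i j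
      }

module HClasses {c ℓ} (K : ACF0 c ℓ) (k m : ℕ)
                (L : Subset (Matrices.n K k m)) ([k]⊆L : ∀ i → toℕ i < k → i ∈ L) where
  open ACF0 K
  open Matrices K k m
  open BlockMatrices K k m
  open CommutativeRingLemmas commRing
  open GroupProperties +-group using (identityʳ-unique)
  open InM

  -- Entrywise description of the 𝓗-class of R when R ∈ J_{1_L} (see ∈H⇒∈Hᴸ and ∈Hᴸ⇒∈H).
  record _∈Hᴸ_ (Y R : Mat) : Set (c ⊔ ℓ) where
    field
      inM    : InM Y
      unit   : ∀ j → k ≤ toℕ j → j ∈ L → Σ Carrier (λ y → Y j j * y ≈ 1#)
      null   : ∀ j → k ≤ toℕ j → j ∉ L → Y j j ≈ 0#
      column : ∀ i j → toℕ i < k → k ≤ toℕ j → j ∉ L → Y i j ≈ R i j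

  -- E is the identity element of the group H_R.
  record IsIdentityᴸ (R E : Mat) : Set ℓ where
    field
      isInM    : InM E
      diag-∈   : ∀ j → k ≤ toℕ j → j ∈ L → E j j ≈ 1#
      diag-∉   : ∀ j → k ≤ toℕ j → j ∉ L → E j j ≈ 0#
      column-∈ : ∀ i j → toℕ i < k → k ≤ toℕ j → j ∈ L → E i j ≈ 0#
      column-∉ : ∀ i j → toℕ i < k → k ≤ toℕ j → j ∉ L → E i j ≈ R i j

  open _∈Hᴸ_
  open IsIdentityᴸ

  one∈M : InM (one L)
  one∈M = InM-one L [k]⊆L

  columnsByL : (Fin n → Fin n → Carrier) → (Fin n → Fin n → Carrier) → Fin n → Fin n → Carrier
  columnsByL f g i j with j ∈? L
  ... | yes _ = f i j
  ... | no  _ = g i j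

  module _ {f g : Fin n → Fin n → Carrier} where

    columnsByL-∈ : ∀ i j → j ∈ L → columnsByL f g i j ≈ f i j
    columnsByL-∈ i j j∈L with j ∈? L
    ... | yes _   = refl
    ... | no  j∉L = contradiction j∈L j∉L

    columnsByL-∉ : ∀ i j → j ∉ L → columnsByL f g i j ≈ g i j
    columnsByL-∉ i j j∉L with j ∈? L
    ... | yes j∈L = contradiction j∈L j∉L
    ... | no  _   = refl

  IsIdentityᴸ⇒∈Hᴸ : ∀ {R E} → IsIdentityᴸ R E → E ∈Hᴸ R
  IsIdentityᴸ⇒∈Hᴸ E-id = record
    { inM    = isInM E-id
    ; unit   = λ j k≤j j∈L → 1# , trans (*-identityʳ _) (diag-∈ E-id j k≤j j∈L)
    ; null   = diag-∉ E-id
    ; column = column-∉ E-id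
    }

  identityᴸ-unique : ∀ {R E E′} → IsIdentityᴸ R E → IsIdentityᴸ R E′ → E ≋ E′
  identityᴸ-unique {E = E} {E′} E-id E′-id = ≋-byBlocks (isInM E-id) (isInM E′-id) diag≈ block≈
    where
    diag≈ : ∀ j → k ≤ toℕ j → E j j ≈ E′ j j
    diag≈ j k≤j with j ∈? L
    ... | yes j∈L = trans (diag-∈ E-id j k≤j j∈L) (sym (diag-∈ E′-id j k≤j j∈L))
    ... | no  j∉L = trans (diag-∉ E-id j k≤j j∉L) (sym (diag-∉ E′-id j k≤j j∉L))
    block≈ : ∀ i j → toℕ i < k → k ≤ toℕ j → E i j ≈ E′ i j
    block≈ i j i<k k≤j with j ∈? L
    ... | yes j∈L = trans (column-∈ E-id i j i<k k≤j j∈L) (sym (column-∈ E′-id i j i<k k≤j j∈L))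
    ... | no  j∉L = trans (column-∉ E-id i j i<k k≤j j∉L) (sym (column-∉ E′-id i j i<k k≤j j∉L))

  identityᴸ-·ˡ : ∀ {R S E Y} → IsIdentityᴸ R E → Y ∈Hᴸ S → E · Y ≋ Y
  identityᴸ-·ˡ {E = E} {Y} E-id Y∈ = ≋-byBlocks (InM-· (isInM E-id) (inM Y∈)) (inM Y∈) diag≈ block≈
    where
    diag≈ : ∀ j → k ≤ toℕ j → (E · Y) j j ≈ Y j j
    diag≈ j k≤j with j ∈? L
    ... | yes j∈L = trans (·-diag (isInM E-id) (inM Y∈) j k≤j)
                          (trans (*-congʳ (diag-∈ E-id j k≤j j∈L)) (*-identityˡ _))
    ... | no  j∉L = trans (·-diag (isInM E-id) (inM Y∈) j k≤j)
                          (trans (*-≈0ʳ (null Y∈ j k≤j j∉L)) (sym (null Y∈ j k≤j j∉L)))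
    block≈ : ∀ i j → toℕ i < k → k ≤ toℕ j → (E · Y) i j ≈ Y i j
    block≈ i j i<k k≤j with j ∈? L
    ... | yes j∈L = trans (·-block (isInM E-id) (inM Y∈) i j i<k k≤j) (+-*-≈0ˡ (column-∈ E-id i j i<k k≤j j∈L))
    ... | no  j∉L = trans (·-block (isInM E-id) (inM Y∈) i j i<k k≤j) (+-*-≈0ʳ (null Y∈ j k≤j j∉L))

  identityᴸ-·ʳ : ∀ {R E Y} → IsIdentityᴸ R E → Y ∈Hᴸ R → Y · E ≋ Y
  identityᴸ-·ʳ {E = E} {Y} E-id Y∈ = ≋-byBlocks (InM-· (inM Y∈) (isInM E-id)) (inM Y∈) diag≈ block≈
    where
    diag≈ : ∀ j → k ≤ toℕ j → (Y · E) j j ≈ Y j j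
    diag≈ j k≤j with j ∈? L
    ... | yes j∈L = trans (·-diag (inM Y∈) (isInM E-id) j k≤j) (*-≈1ʳ (diag-∈ E-id j k≤j j∈L))
    ... | no  j∉L = trans (·-diag (inM Y∈) (isInM E-id) j k≤j)
                          (trans (*-≈0ʳ (diag-∉ E-id j k≤j j∉L)) (sym (null Y∈ j k≤j j∉L)))
    block≈ : ∀ i j → toℕ i < k → k ≤ toℕ j → (Y · E) i j ≈ Y i j
    block≈ i j i<k k≤j with j ∈? L
    ... | yes j∈L = trans (·-block (inM Y∈) (isInM E-id) i j i<k k≤j)
                          (trans (+-≈0ˡ (column-∈ E-id i j i<k k≤j j∈L)) (*-≈1ʳ (diag-∈ E-id j k≤j j∈L)))
    ... | no  j∉L = trans (·-block (inM Y∈) (isInM E-id) i j i<k k≤j)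
                          (trans (+-*-≈0ʳ (diag-∉ E-id j k≤j j∉L))
                                 (trans (column-∉ E-id i j i<k k≤j j∉L) (sym (column Y∈ i j i<k k≤j j∉L))))

  ·-∈Hᴸ : ∀ {R S Y Z} → Y ∈Hᴸ S → Z ∈Hᴸ R → (Y · Z) ∈Hᴸ R
  ·-∈Hᴸ Y∈ Z∈ = record
    { inM    = InM-· (inM Y∈) (inM Z∈)
    ; unit   = λ j k≤j j∈L →
        let (y , yy≈1) = unit Y∈ j k≤j j∈L ; (z , zz≈1) = unit Z∈ j k≤j j∈L in
        y * z , trans (*-congʳ (·-diag (inM Y∈) (inM Z∈) j k≤j)) (unit-* yy≈1 zz≈1)
    ; null   = λ j k≤j j∉L → trans (·-diag (inM Y∈) (inM Z∈) j k≤j) (*-≈0ʳ (null Z∈ j k≤j j∉L))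
    ; column = λ i j i<k k≤j j∉L → trans (·-block (inM Y∈) (inM Z∈) i j i<k k≤j)
                                         (trans (+-*-≈0ʳ (null Z∈ j k≤j j∉L)) (column Z∈ i j i<k k≤j j∉L))
    }

  module _ {Y R} (Y∈ : Y ∈Hᴸ R) where

    diagInverse : Fin n → Carrier
    diagInverse j with k ≤? toℕ j | j ∈? L
    ... | yes k≤j | yes j∈L = proj₁ (unit Y∈ j k≤j j∈L)
    ... | _       | _       = 0#

    diagInverse-∈ : ∀ j → k ≤ toℕ j → j ∈ L → Y j j * diagInverse j ≈ 1#
    diagInverse-∈ j k≤j j∈L with k ≤? toℕ j | j ∈? L
    ... | yes k≤j′ | yes j∈L′ = proj₂ (unit Y∈ j k≤j′ j∈L′)
    ... | yes _    | no  j∉L  = contradiction j∈L j∉L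
    ... | no  k≰j  | _        = contradiction k≤j k≰j

    diagInverse-∉ : ∀ j → j ∉ L → diagInverse j ≈ 0#
    diagInverse-∉ j j∉L with k ≤? toℕ j | j ∈? L
    ... | yes _ | yes j∈L = contradiction j∈L j∉L
    ... | yes _ | no  _   = refl
    ... | no  _ | _       = refl

    blockInverse : Fin n → Fin n → Carrier
    blockInverse = columnsByL (λ i j → - (Y i j * diagInverse j)) Y

    groupInverse : Mat
    groupInverse = fromBlocks diagInverse blockInverse

    private
      Yi : Mat
      Yi = groupInverse
      Yi∈M : InM Yi
      Yi∈M = InM-fromBlocks diagInverse blockInverse

      Yi-diag : ∀ j → k ≤ toℕ j → Yi j j ≈ diagInverse j
      Yi-diag = fromBlocks-diag diagInverse blockInverse

      Yi-block : ∀ i j → toℕ i < k → k ≤ toℕ j → Yi i j ≈ blockInverse i j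
      Yi-block = fromBlocks-block diagInverse blockInverse

    groupInverse-∈Hᴸ : groupInverse ∈Hᴸ R
    groupInverse-∈Hᴸ = record
      { inM    = Yi∈M
      ; unit   = λ j k≤j j∈L → Y j j ,
          trans (*-congʳ (Yi-diag j k≤j)) (trans (*-comm _ _) (diagInverse-∈ j k≤j j∈L))
      ; null   = λ j k≤j j∉L → trans (Yi-diag j k≤j) (diagInverse-∉ j j∉L)
      ; column = λ i j i<k k≤j j∉L →
          trans (Yi-block i j i<k k≤j) (trans (columnsByL-∉ i j j∉L) (column Y∈ i j i<k k≤j j∉L))
      }

    ·groupInverse : IsIdentityᴸ R (Y · groupInverse)
    ·groupInverse = record
      { isInM    = InM-· (inM Y∈) Yi∈M
      ; diag-∈   = λ j k≤j j∈L → trans (·-diag (inM Y∈) Yi∈M j k≤j)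
                                       (trans (*-congˡ (Yi-diag j k≤j)) (diagInverse-∈ j k≤j j∈L))
      ; diag-∉   = λ j k≤j j∉L → trans (·-diag (inM Y∈) Yi∈M j k≤j) (*-≈0ˡ (null Y∈ j k≤j j∉L))
      ; column-∈ = λ i j i<k k≤j j∈L → trans (·-block (inM Y∈) Yi∈M i j i<k k≤j)
          (trans (+-cong (trans (Yi-block i j i<k k≤j) (columnsByL-∈ i j j∈L)) (*-congˡ (Yi-diag j k≤j)))
                 (-‿inverseˡ _))
      ; column-∉ = λ i j i<k k≤j j∉L → trans (·-block (inM Y∈) Yi∈M i j i<k k≤j)
          (trans (+-*-≈0ʳ (trans (Yi-diag j k≤j) (diagInverse-∉ j j∉L)))
                 (column groupInverse-∈Hᴸ i j i<k k≤j j∉L))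
      }

    groupInverse· : IsIdentityᴸ R (groupInverse · Y)
    groupInverse· = record
      { isInM    = InM-· Yi∈M (inM Y∈)
      ; diag-∈   = λ j k≤j j∈L → trans (·-diag Yi∈M (inM Y∈) j k≤j)
          (trans (*-congʳ (Yi-diag j k≤j)) (trans (*-comm _ _) (diagInverse-∈ j k≤j j∈L)))
      ; diag-∉   = λ j k≤j j∉L → trans (·-diag Yi∈M (inM Y∈) j k≤j) (*-≈0ˡ (null groupInverse-∈Hᴸ j k≤j j∉L))
      ; column-∈ = λ i j i<k k≤j j∈L → trans (·-block Yi∈M (inM Y∈) i j i<k k≤j)
          (trans (+-congˡ (*-congʳ (trans (Yi-block i j i<k k≤j) (columnsByL-∈ i j j∈L))))
                 (+-neg-*-unit (Y i j) (diagInverse-∈ j k≤j j∈L)))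
      ; column-∉ = λ i j i<k k≤j j∉L → trans (·-block Yi∈M (inM Y∈) i j i<k k≤j)
          (trans (+-*-≈0ʳ (null Y∈ j k≤j j∉L)) (column Y∈ i j i<k k≤j j∉L))
      }

  ∈Hᴸ⇒≤R : ∀ {R X Y} → X ∈Hᴸ R → Y ∈Hᴸ R → X ≤R Y
  ∈Hᴸ⇒≤R {X = X} {Y} X∈ Y∈ = groupInverse Y∈ · X , InM-· (inM (groupInverse-∈Hᴸ Y∈)) (inM X∈) , X≋
    where
    open import Relation.Binary.Reasoning.Setoid ≋-setoid
    X≋ : X ≋ Y · (groupInverse Y∈ · X)
    X≋ = begin
      X                            ≈⟨ identityᴸ-·ˡ (·groupInverse Y∈) X∈ ⟨
      (Y · groupInverse Y∈) · X    ≈⟨ ·-assoc (inM Y∈) (inM (groupInverse-∈Hᴸ Y∈)) (inM X∈) ⟩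
      Y · (groupInverse Y∈ · X)    ∎

  ∈Hᴸ⇒≤L : ∀ {R X Y} → X ∈Hᴸ R → Y ∈Hᴸ R → X ≤L Y
  ∈Hᴸ⇒≤L {X = X} {Y} X∈ Y∈ = X · groupInverse Y∈ , InM-· (inM X∈) (inM (groupInverse-∈Hᴸ Y∈)) , X≋
    where
    open import Relation.Binary.Reasoning.Setoid ≋-setoid
    X≋ : X ≋ (X · groupInverse Y∈) · Y
    X≋ = begin
      X                            ≈⟨ identityᴸ-·ʳ (groupInverse· Y∈) X∈ ⟨
      X · (groupInverse Y∈ · Y)    ≈⟨ ·-assoc (inM X∈) (inM (groupInverse-∈Hᴸ Y∈)) (inM Y∈) ⟨
      (X · groupInverse Y∈) · Y    ∎

  ∈Hᴸ⇒∈H : ∀ {R X Y} → X ∈Hᴸ R → Y ∈Hᴸ R → X ∈H Y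
  ∈Hᴸ⇒∈H X∈ Y∈ =
    inM X∈ , (∈Hᴸ⇒≤R X∈ Y∈ , ∈Hᴸ⇒≤R Y∈ X∈) , (∈Hᴸ⇒≤L X∈ Y∈ , ∈Hᴸ⇒≤L Y∈ X∈)

  ∈H⇒∈Hᴸ : ∀ {R Y} → R ∈Hᴸ R → Y ∈H R → Y ∈Hᴸ R
  ∈H⇒∈Hᴸ R∈ (Y∈M , _ , (U , U∈M , Y≋UR) , (U′ , U′∈M , R≋U′Y)) = record
    { inM    = Y∈M
    ; unit   = λ j k≤j j∈L → let (r , Rr≈1) = unit R∈ j k≤j j∈L in
        U′ j j * r , unit-factorʳ (trans (*-congʳ (trans (sym (·-diag U′∈M Y∈M j k≤j)) (sym (R≋U′Y j j)))) Rr≈1)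
    ; null   = λ j k≤j j∉L →
        trans (Y≋UR j j) (trans (·-diag U∈M (inM R∈) j k≤j) (*-≈0ʳ (null R∈ j k≤j j∉L)))
    ; column = λ i j i<k k≤j j∉L →
        trans (Y≋UR i j) (trans (·-block U∈M (inM R∈) i j i<k k≤j) (+-*-≈0ʳ (null R∈ j k≤j j∉L)))
    }

  ∈J⇒∈Hᴸ : ∀ {X} → InM X → X ∈J one L → X ∈Hᴸ X
  ∈J⇒∈Hᴸ {X} X∈M (_ , (U , V , U∈M , V∈M , X≋U1V) , (U′ , V′ , U′∈M , V′∈M , 1≋U′XV′)) = record
    { inM    = X∈M
    ; unit   = λ j k≤j j∈L → U′ j j * V′ j j , unit-factorʳ (begin
        U′ j j * X j j * V′ j j      ≈⟨ *-congʳ (·-diag U′∈M X∈M j k≤j) ⟨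
        (U′ · X) j j * V′ j j        ≈⟨ ·-diag (InM-· U′∈M X∈M) V′∈M j k≤j ⟨
        (U′ · X · V′) j j            ≈⟨ 1≋U′XV′ j j ⟨
        one L j j                    ≈⟨ one-∈ L j j∈L ⟩
        1#                           ∎)
    ; null   = λ j k≤j j∉L → begin
        X j j                        ≈⟨ X≋U1V j j ⟩
        (U · one L · V) j j          ≈⟨ ·-diag (InM-· U∈M one∈M) V∈M j k≤j ⟩
        (U · one L) j j * V j j      ≈⟨ *-congʳ (·-diag U∈M one∈M j k≤j) ⟩
        U j j * one L j j * V j j    ≈⟨ *-≈0ˡ (*-≈0ʳ (one-∉ L j j∉L)) ⟩
        0#                           ∎
    ; column = λ _ _ _ _ _ → refl
    }
    where
    open import Relation.Binary.Reasoning.Setoid setoid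

  one-identityᴸ : IsIdentityᴸ (one L) (one L)
  one-identityᴸ = record
    { isInM    = one∈M
    ; diag-∈   = λ j _ → one-∈ L j
    ; diag-∉   = λ j _ → one-∉ L j
    ; column-∈ = λ i j i<k k≤j _ → one-≢ L i j (<k≤⇒≢ i<k k≤j)
    ; column-∉ = λ _ _ _ _ _ → refl
    }

  one-∈Hᴸ : one L ∈Hᴸ one L
  one-∈Hᴸ = IsIdentityᴸ⇒∈Hᴸ one-identityᴸ

  groupInverse-identityᴸ : ∀ {X Xi} → X ∈Hᴸ X → IsGroupInverse X Xi → IsIdentityᴸ X (X · Xi)
  groupInverse-identityᴸ {X} {Xi} X∈ Xi-inv = record
    { isInM    = E∈M
    ; diag-∈   = λ j k≤j j∈L → unit-cancelʳ (proj₂ (unit X∈ j k≤j j∈L)) (trans (sym (·-diag E∈M (inM X∈) j k≤j)) (trans (EX≋X j j) (sym (*-identityˡ _))))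
    ; diag-∉   = λ j k≤j j∉L → trans (·-diag (inM X∈) (inM Xi∈) j k≤j) (*-≈0ˡ (null X∈ j k≤j j∉L))
    ; column-∈ = λ i j i<k k≤j j∈L → unit-cancelʳ (proj₂ (unit X∈ j k≤j j∈L)) (trans (identityʳ-unique (X i j) _
          (trans (sym (·-block E∈M (inM X∈) i j i<k k≤j)) (EX≋X i j))) (sym (zeroˡ _)))
    ; column-∉ = λ i j i<k k≤j j∉L → trans (·-block (inM X∈) (inM Xi∈) i j i<k k≤j)
        (trans (+-*-≈0ʳ (null Xi∈ j k≤j j∉L)) (column Xi∈ i j i<k k≤j j∉L))
    }
    where
    Xi∈ : Xi ∈Hᴸ X
    Xi∈ = ∈H⇒∈Hᴸ X∈ (IsGroupInverse.inH Xi-inv)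
    E∈M : InM (X · Xi)
    E∈M = InM-· (inM X∈) (inM Xi∈)
    EX≋X : X · Xi · X ≋ X
    EX≋X = IsGroupInverse.unitL Xi-inv

  module _ {X} (X∈ : X ∈Hᴸ X) where
    open import Relation.Binary.Reasoning.Setoid ≋-setoid

    ρ-∈H : ∀ Y → Y ∈H X → (Y · one L) ∈H one L
    ρ-∈H Y Y∈H = ∈Hᴸ⇒∈H (·-∈Hᴸ (∈H⇒∈Hᴸ X∈ Y∈H) one-∈Hᴸ) one-∈Hᴸ

    ρ-homomorphic : ∀ Y Z → Y ∈H X → Z ∈H X → (Y · Z) · one L ≋ (Y · one L) · (Z · one L)
    ρ-homomorphic Y Z (Y∈M , _) Z∈H = begin
      (Y · Z) · one L               ≈⟨ ·-assoc Y∈M (inM Z∈) one∈M ⟩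
      Y · (Z · one L)               ≈⟨ ·-congˡ (identityᴸ-·ˡ one-identityᴸ (·-∈Hᴸ Z∈ one-∈Hᴸ)) ⟨
      Y · (one L · (Z · one L))     ≈⟨ ·-assoc Y∈M one∈M (InM-· (inM Z∈) one∈M) ⟨
      (Y · one L) · (Z · one L)     ∎
      where
      Z∈ : Z ∈Hᴸ X
      Z∈ = ∈H⇒∈Hᴸ X∈ Z∈H

    groupInverse-isGroupInverse : IsGroupInverse X (groupInverse X∈)
    groupInverse-isGroupInverse = record
      { inH      = ∈Hᴸ⇒∈H (groupInverse-∈Hᴸ X∈) X∈
      ; commutes = identityᴸ-unique (·groupInverse X∈) (groupInverse· X∈)
      ; unitL    = identityᴸ-·ˡ (·groupInverse X∈) X∈
      }

    module _ {Xi} (Xi-inv : IsGroupInverse X Xi) where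
      private
        E-id : IsIdentityᴸ X (X · Xi)
        E-id = groupInverse-identityᴸ X∈ Xi-inv
        Xi∈ : Xi ∈Hᴸ X
        Xi∈ = ∈H⇒∈Hᴸ X∈ (IsGroupInverse.inH Xi-inv)

      ρ⁻¹-∈H : ∀ Z → Z ∈H one L → (Z · X · Xi) ∈H X
      ρ⁻¹-∈H Z Z∈H = ∈Hᴸ⇒∈H (·-∈Hᴸ (·-∈Hᴸ (∈H⇒∈Hᴸ one-∈Hᴸ Z∈H) X∈) Xi∈) X∈

      ρ∘ρ⁻¹ : ∀ Z → Z ∈H one L → (Z · X · Xi) · one L ≋ Z
      ρ∘ρ⁻¹ Z Z∈H = begin
        (Z · X · Xi) · one L        ≈⟨ ·-congʳ (·-assoc Z∈M (inM X∈) (inM Xi∈)) ⟩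
        (Z · (X · Xi)) · one L      ≈⟨ ·-assoc Z∈M (isInM E-id) one∈M ⟩
        Z · ((X · Xi) · one L)      ≈⟨ ·-congˡ (identityᴸ-·ˡ E-id one-∈Hᴸ) ⟩
        Z · one L                   ≈⟨ identityᴸ-·ʳ one-identityᴸ (∈H⇒∈Hᴸ one-∈Hᴸ Z∈H) ⟩
        Z                           ∎
        where
        Z∈M : InM Z
        Z∈M = proj₁ Z∈H

      ρ⁻¹∘ρ : ∀ Y → Y ∈H X → (Y · one L) · X · Xi ≋ Y
      ρ⁻¹∘ρ Y Y∈H = begin
        (Y · one L) · X · Xi        ≈⟨ ·-assoc (InM-· Y∈M one∈M) (inM X∈) (inM Xi∈) ⟩
        (Y · one L) · (X · Xi)      ≈⟨ ·-assoc Y∈M one∈M (isInM E-id) ⟩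
        Y · (one L · (X · Xi))      ≈⟨ ·-congˡ (identityᴸ-·ˡ one-identityᴸ (IsIdentityᴸ⇒∈Hᴸ E-id)) ⟩
        Y · (X · Xi)                ≈⟨ identityᴸ-·ʳ E-id (∈H⇒∈Hᴸ X∈ Y∈H) ⟩
        Y                           ∎
        where
        Y∈M : InM Y
        Y∈M = proj₁ Y∈H

proposition6p3 : ∀ {c ℓ} (K : ACF0 c ℓ) (k m : ℕ) → 1 ≤ k → 1 ≤ m →
    let open Matrices K k m in
    (X : Mat) → InM X →
    (L : Subset n) → (∀ (i : Fin n) → toℕ i < k → i ∈ L) →
    X ∈J one L →
    -- ρ maps H_X into H_{1_L}
    (∀ Y → Y ∈H X → (Y · one L) ∈H one L)
    -- ρ is a homomorphism
    × (∀ Y Z → Y ∈H X → Z ∈H X → ((Y · Z) · one L) ≋ (Y · one L) · (Z · one L))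
    -- X has an inverse in the group H_X
    × Σ Mat (λ Xi → IsGroupInverse X Xi)
    -- for the inverse X⁻¹ of X in H_X, Y ↦ Y X X⁻¹ is a two-sided inverse of ρ
    × (∀ Xi → IsGroupInverse X Xi →
        (∀ Z → Z ∈H one L → (Z · X · Xi) ∈H X)
        × (∀ Z → Z ∈H one L → (Z · X · Xi) · one L ≋ Z)
        × (∀ Y → Y ∈H X → (Y · one L) · X · Xi ≋ Y))
proposition6p3 K k m _ _ X X∈M L [k]⊆L X∈J =
  ρ-∈H X∈ , ρ-homomorphic X∈ , (groupInverse X∈ , groupInverse-isGroupInverse X∈) ,
  λ Xi Xi-inv → ρ⁻¹-∈H X∈ Xi-inv , ρ∘ρ⁻¹ X∈ Xi-inv , ρ⁻¹∘ρ X∈ Xi-inv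
  where
  open HClasses K k m L [k]⊆L
  X∈ : X ∈Hᴸ X
  X∈ = ∈J⇒∈Hᴸ X∈M X∈J
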